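{- Let $i \in \mathit{Agt}$ and let $\mathsf{O}$ be any one of the four operators $\mathsf{A}_i$, $\mathsf{R}_i$, $\mathsf{A}^{\mathsf{real}}_i$, $\mathsf{R}^{\mathsf{real}}_i$ of the language $\mathcal{L}$. Then $\mathsf{O}$ is not expressible with the other modalities of $\mathcal{L}$ (including the other three of these operators): there is an atomic proposition $p \in \mathit{Atm}$ such that there is no formula $\psi \in \mathcal{L}$ in which $\mathsf{O}$ does not occur with $\models \mathsf{O}\,p \leftrightarrow \psi$.
   Context: Fix a countably infinite set $\mathit{Atm}$ of atomic propositions and a finite set of agents $\mathit{Agt}=\{1,\dots,n\}$. For every $i\in\mathit{Agt}$, $\mathit{Atm}$ contains two distinguished atoms $\mathit{good}_i$ ("$i$ gets a reward") and $\mathit{bad}_i$ ("$i$ gets a punishment"). The language $\mathcal{L}_0$ of explicit belief is $\alpha ::= p \mid \neg\alpha \mid \alpha\wedge\alpha \mid \triangle_i\alpha$ with $p\in\mathit{Atm}$, $i\in\mathit{Agt}$; $\top,\bot,\vee,\rightarrow,\leftrightarrow$ are the usual abbreviations. A state is a tuple $S=((B_i)_{i\in\mathit{Agt}},V)$ with $B_i\subseteq\mathcal{L}_0$ (agent $i$'s belief base) and $V\subseteq\mathit{Atm}$; $\mathbf{S}$ is the set of all states. For $\alpha\in\mathcal{L}_0$: $S\models p$ iff $p\in V$; Boolean connectives as usual; $S\models\triangle_i\alpha$ iff $\alpha\in B_i$. Define $\mathit{Des}_i(S)=\{\alpha\in\mathcal{L}_0 : (\alpha\rightarrow\mathit{good}_i)\in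 B_i\}$ and $\mathit{Undes}_i(S)=\{\alpha\in\mathcal{L}_0 : (\alpha\rightarrow\mathit{bad}_i)\in B_i\}$. Binary relations on $\mathbf{S}$: $S\,\mathcal{E}_i\,S'$ iff $S'\models\alpha$ for all $\alpha\in B_i$ (where $B_i$ is $i$'s base in $S$); $S\,\mathcal{A}_i\,S'$ iff there is $\alpha\in\mathit{Des}_i(S)$ with $S'\models\alpha$; $S\,\mathcal{R}_i\,S'$ iff there is $\alpha\in\mathit{Undes}_i(S)$ with $S'\models\alpha$. A model is a pair $(S,U)$ with $S\in U\subseteq\mathbf{S}$. The language $\mathcal{L}$ is $\varphi ::= \alpha \mid \neg\varphi\mid\varphi\wedge\varphi\mid \Box_i\varphi \mid \mathsf{A}_i\varphi\mid\mathsf{R}_i\varphi\mid\mathsf{A}^{\mathsf{real}}_i\varphi\mid\mathsf{R}^{\mathsf{real}}_i\varphi$ with $\alpha\in\mathcal{L}_0$, $i\in\mathit{Agt}$. Semantics: $(S,U)\models\alpha$ iff $S\models\alpha$; Boolean as usual; $(S,U)\models\Box_i\varphi$ iff for all $S'\in U$ with $S\,\mathcal{E}_i\,S'$, $(S',U)\models\varphi$; $(S,U)\models\mathsf{A}_i\varphi$ iff for all $S'\in U$ with $(S',U)\models\varphi$, $S\,\mathcal{A}_i\,S'$; $(S,U)\models\mathsf{R}_i\varphi$ iff for all $S'\in U$ with $(S',U)\models\varphi$, $S\,\mathcal{R}_i\,S'$; $(S,U)\models\mathsf{A}^{\mathsf{real}}_i\varphi$ iff for all $S'\in U$ with $(S',U)\models\varphi$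 and $S\,\mathcal{E}_i\,S'$, $S\,\mathcal{A}_i\,S'$; $(S,U)\models\mathsf{R}^{\mathsf{real}}_i\varphi$ iff for all $S'\in U$ with $(S',U)\models\varphi$ and $S\,\mathcal{E}_i\,S'$, $S\,\mathcal{R}_i\,S'$. A formula $\varphi$ is valid, written $\models\varphi$, if $(S,U)\models\varphi$ for every model $(S,U)$. -}

module Defs where

open import Level using (Level; Lift; lift) renaming (suc to lsuc; zero to lzero)
open import Data.Nat using (ℕ)
open import Data.Fin using (Fin)
open import Data.Product using (Σ; _×_; _,_)
open import Data.Empty using (⊥)
open import Relation.Nullary using (¬_)
open import Relation.Binary.PropositionalEquality using (_≡_)

data Atm (n : ℕ) : Set where
  good : Fin n → Atm n
  bad  : Fin n → Atm n
  atm  : ℕ → Atm n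

data Form₀ (n : ℕ) : Set where
  atom : Atm n → Form₀ n
  ¬₀_  : Form₀ n → Form₀ n
  _∧₀_ : Form₀ n → Form₀ n → Form₀ n
  △    : Fin n → Form₀ n → Form₀ n

_⇒₀_ : ∀ {n} → Form₀ n → Form₀ n → Form₀ n
α ⇒₀ β = ¬₀ (α ∧₀ (¬₀ β))

record State (n : ℕ) : Set₁ where
  field
    B : Fin n → Form₀ n → Set
    V : Atm n → Set
open State public

_⊨₀_ : ∀ {n} → State n → Form₀ n → Set
S ⊨₀ atom p   = V S p
S ⊨₀ (¬₀ α)   = ¬ (S ⊨₀ α)
S ⊨₀ (α ∧₀ β) = (S ⊨₀ α) × (S ⊨₀ β)
S ⊨₀ △ i α    = B S i α

Des : ∀ {n} → Fin n → State n → Form₀ n → Set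
Des i S α = B S i (α ⇒₀ atom (good i))

Undes : ∀ {n} → Fin n → State n → Form₀ n → Set
Undes i S α = B S i (α ⇒₀ atom (bad i))

ℰ : ∀ {n} → Fin n → State n → State n → Set
ℰ i S S' = ∀ α → B S i α → S' ⊨₀ α

𝒜 : ∀ {n} → Fin n → State n → State n → Set
𝒜 i S S' = Σ (Form₀ _) λ α → Des i S α × (S' ⊨₀ α)

ℛ : ∀ {n} → Fin n → State n → State n → Set
ℛ i S S' = Σ (Form₀ _) λ α → Undes i S α × (S' ⊨₀ α)

data Form (n : ℕ) : Set where
  emb   : Form₀ n → Form n
  ¬'_   : Form n → Form n
  _∧'_  : Form n → Form n → Form n
  □     : Fin n → Form n → Form n
  𝖠     : Fin n → Form n → Form n
  𝖱     : Fin n → Form n → Form n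
  𝖠real : Fin n → Form n → Form n
  𝖱real : Fin n → Form n → Form n

_⇒'_ : ∀ {n} → Form n → Form n → Form n
φ ⇒' ψ = ¬' (φ ∧' (¬' ψ))

_⇔'_ : ∀ {n} → Form n → Form n → Form n
φ ⇔' ψ = (φ ⇒' ψ) ∧' (ψ ⇒' φ)

Universe : ℕ → Set₁
Universe n = State n → Set

sat : ∀ {n} → Universe n → State n → Form n → Set₁
sat U S (emb α)     = Lift _ (S ⊨₀ α)
sat U S (¬' φ)      = ¬ sat U S φ
sat U S (φ ∧' ψ)    = sat U S φ × sat U S ψ
sat U S (□ i φ)     = ∀ S' → U S' → ℰ i S S' → sat U S' φ
sat U S (𝖠 i φ)     = ∀ S' → U S' → sat U S' φ → 𝒜 i S S'
sat U S (𝖱 i φ)     = ∀ S' → U S' → sat U S' φ → ℛ i S S'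
sat U S (𝖠real i φ) = ∀ S' → U S' → sat U S' φ → ℰ i S S' → 𝒜 i S S'
sat U S (𝖱real i φ) = ∀ S' → U S' → sat U S' φ → ℰ i S S' → ℛ i S S'

Valid : ∀ {n} → Form n → Set₁
Valid {n} φ = ∀ (U : Universe n) (S : State n) → U S → sat U S φ

data Op : Set where
  opA opR opAreal opRreal : Op

app : ∀ {n} → Op → Fin n → Form n → Form n
app opA     i φ = 𝖠 i φ
app opR     i φ = 𝖱 i φ
app opAreal i φ = 𝖠real i φ
app opRreal i φ = 𝖱real i φ

data NoOcc {n : ℕ} (O : Op) (i : Fin n) : Form n → Set where
  emb   : ∀ α → NoOcc O i (emb α)
  ¬'_   : ∀ {φ} → NoOcc O i φ → NoOcc O i (¬' φ)
  _∧'_  : ∀ {φ ψ} → NoOcc O i φ → NoOcc O i ψ → NoOcc O i (φ ∧' ψ)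
  □     : ∀ j {φ} → NoOcc O i φ → NoOcc O i (□ j φ)
  𝖠     : ∀ j {φ} → ¬ (O ≡ opA × j ≡ i) → NoOcc O i φ → NoOcc O i (𝖠 j φ)
  𝖱     : ∀ j {φ} → ¬ (O ≡ opR × j ≡ i) → NoOcc O i φ → NoOcc O i (𝖱 j φ)
  𝖠real : ∀ j {φ} → ¬ (O ≡ opAreal × j ≡ i) → NoOcc O i φ → NoOcc O i (𝖠real j φ)
  𝖱real : ∀ j {φ} → ¬ (O ≡ opRreal × j ≡ i) → NoOcc O i φ → NoOcc O i (𝖱real j φ)

-- Given ψ, take three atoms q, r, s not occurring in ψ and consider the states whose
-- belief bases are {q → good_i, s → bad_i, r} for i and empty for the other agents, and
-- in which every other atom is true.  Such a state is determined by the truth values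
-- (q, r, s); its ℰ_i-successors are the r-states, its 𝒜_i-successors the q-states, its
-- ℛ_i-successors the s-states, and agents other than i have no 𝒜- or ℛ-successors.
-- In the universe {(⊤,⊤,⊤), t} a formula avoiding q, r, s has the same truth value at
-- all states, and this value depends on t only through the four bits q, s, r → q,
-- r → s, which are the values of 𝖠_i p, 𝖱_i p, 𝖠real_i p, 𝖱real_i p for an atom p true
-- everywhere.  For each operator O, two choices of t agree on the bits of the other
-- three operators but not on that of O, so no formula without O_i is equivalent to O_i p.
module Submission where

open import Defs
open import Level using (lift)
open import Data.Nat using (ℕ; _+_; _∸_; _≤_; _⊔_; z≤n)
open import Data.Nat.Properties using (m+n∸n≡m; m≤n⇒m∸n≡0; m⊔n≤o⇒m≤o; m⊔n≤o⇒n≤o; ≤-refl)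
open import Data.Fin using (Fin)
open import Data.Bool using (Bool; true; false; T)
open import Data.Unit using (tt)
open import Data.Empty using (⊥-elim)
open import Data.Product using (Σ; Σ-syntax; _×_; _,_; proj₁; proj₂)
open import Data.Sum using (_⊎_; inj₁; inj₂)
open import Relation.Nullary using (¬_)
open import Relation.Binary.PropositionalEquality using (_≡_; refl; sym; cong; subst)

app-fromSatisfiable : ∀ {n} {U : Universe n} {S : State n} O k φ →
  (∀ S' → U S' → sat U S' φ → sat U S (app O k φ)) → sat U S (app O k φ)
app-fromSatisfiable opA     k φ h S' u x = h S' u x S' u x
app-fromSatisfiable opR     k φ h S' u x = h S' u x S' u x
app-fromSatisfiable opAreal k φ h S' u x = h S' u x S' u x
app-fromSatisfiable opRreal k φ h S' u x = h S' u x S' u x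

-- Atoms under △ are not counted: belief bases will be the same in every state.
bound₀ : ∀ {n} → Form₀ n → ℕ
bound₀ (atom (atm k)) = k
bound₀ (atom (good _)) = 0
bound₀ (atom (bad _)) = 0
bound₀ (¬₀ α) = bound₀ α
bound₀ (α ∧₀ β) = bound₀ α ⊔ bound₀ β
bound₀ (△ _ _) = 0

bound : ∀ {n} → Form n → ℕ
bound (emb α) = bound₀ α
bound (¬' φ) = bound φ
bound (φ ∧' ψ) = bound φ ⊔ bound ψ
bound (□ _ φ) = bound φ
bound (𝖠 _ φ) = bound φ
bound (𝖱 _ φ) = bound φ
bound (𝖠real _ φ) = bound φ
bound (𝖱real _ φ) = bound φ

_⇒ᵇ_ : Bool → Bool → Bool
true  ⇒ᵇ y = y
false ⇒ᵇ _ = true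

⇒ᵇ-intro : ∀ x y → (T x → T y) → T (x ⇒ᵇ y)
⇒ᵇ-intro true  y h = h tt
⇒ᵇ-intro false y h = tt

⇒ᵇ-elim : ∀ x y → T (x ⇒ᵇ y) → T x → T y
⇒ᵇ-elim true y h _ = h

record Triple : Set where
  constructor ⟨_,_,_⟩
  field q r s : Bool
open Triple

top : Triple
top = ⟨ true , true , true ⟩

holds : Op → Triple → Bool
holds opA     t = q t
holds opR     t = s t
holds opAreal t = r t ⇒ᵇ q t
holds opRreal t = r t ⇒ᵇ s t

Agree : Op → Triple → Triple → Set
Agree O t t' = ∀ O' → ¬ O ≡ O' → holds O' t ≡ holds O' t'

Agree-sym : ∀ {O t t'} → Agree O t t' → Agree O t' t
Agree-sym ag O' ne = sym (ag O' ne)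

module Construction {n : ℕ} (i : Fin n) (N : ℕ) where

  q̂ r̂ ŝ : Atm n
  q̂ = atm (1 + N)
  r̂ = atm (2 + N)
  ŝ = atm (3 + N)

  fresh : Triple → ℕ → Bool
  fresh t 1 = q t
  fresh t 2 = r t
  fresh t 3 = s t
  fresh t _ = true

  val : Triple → Atm n → Bool
  val t (good _) = true
  val t (bad _)  = true
  val t (atm k)  = fresh t (k ∸ N)

  val-q̂ : ∀ t → val t q̂ ≡ q t
  val-q̂ t = cong (fresh t) (m+n∸n≡m 1 N)

  val-r̂ : ∀ t → val t r̂ ≡ r t
  val-r̂ t = cong (fresh t) (m+n∸n≡m 2 N)

  val-ŝ : ∀ t → val t ŝ ≡ s t
  val-ŝ t = cong (fresh t) (m+n∸n≡m 3 N)

  val-≤ : ∀ t {k} → k ≤ N → val t (atm k) ≡ true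
  val-≤ t k≤N = cong (fresh t) (m≤n⇒m∸n≡0 k≤N)

  beliefs : Fin n → Form₀ n → Set
  beliefs k β = k ≡ i × (β ≡ (atom q̂ ⇒₀ atom (good i)) ⊎ β ≡ (atom ŝ ⇒₀ atom (bad i)) ⊎ β ≡ atom r̂)

  -- Universes are Set-valued while State n : Set₁, so a member of a universe cannot be
  -- asked to be equal to st v, only to agree with it pointwise.
  record Realises (v : Triple) (X : State n) : Set where
    field
      B→ : ∀ {k β} → B X k β → beliefs k β
      B← : ∀ {k β} → beliefs k β → B X k β
      V→ : ∀ {a} → V X a → T (val v a)
      V← : ∀ {a} → T (val v a) → V X a
  open Realises

  st : Triple → State n
  st v = record { B = beliefs ; V = λ a → T (val v a) }

  st-realises : ∀ v → Realises v (st v)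
  st-realises v = record { B→ = λ x → x ; B← = λ x → x ; V→ = λ x → x ; V← = λ x → x }

  U : Triple → Universe n
  U t X = Σ[ v ∈ Triple ] (v ≡ top ⊎ v ≡ t) × Realises v X

  top∈U : ∀ {t} → U t (st top)
  top∈U = top , inj₁ refl , st-realises top

  t∈U : ∀ {t} → U t (st t)
  t∈U = _ , inj₂ refl , st-realises _

  module _ {u v : Triple} {X Y : State n} (ρX : Realises u X) (ρY : Realises v Y) where

    ℰ-intro : ∀ k → T (r v) → ℰ k X Y
    ℰ-intro k rv β x with B→ ρX x
    ... | refl , inj₁ refl        = λ (_ , ¬good) → ¬good (V← ρY tt)
    ... | refl , inj₂ (inj₁ refl) = λ (_ , ¬bad) → ¬bad (V← ρY tt)
    ... | refl , inj₂ (inj₂ refl) = V← ρY (subst T (sym (val-r̂ v)) rv)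

    ℰ-elim : ℰ i X Y → T (r v)
    ℰ-elim e = subst T (val-r̂ v) (V→ ρY (e (atom r̂) (B← ρX (refl , inj₂ (inj₂ refl)))))

    𝒜-intro : T (q v) → 𝒜 i X Y
    𝒜-intro qv = atom q̂ , B← ρX (refl , inj₁ refl) , V← ρY (subst T (sym (val-q̂ v)) qv)

    𝒜-elim : ∀ {k} → 𝒜 k X Y → k ≡ i × T (q v)
    𝒜-elim (_ , d , x) with B→ ρX d
    ... | refl , inj₁ refl        = refl , subst T (val-q̂ v) (V→ ρY x)
    ... | refl , inj₂ (inj₁ ())
    ... | refl , inj₂ (inj₂ ())

    ℛ-intro : T (s v) → ℛ i X Y
    ℛ-intro sv = atom ŝ , B← ρX (refl , inj₂ (inj₁ refl)) , V← ρY (subst T (sym (val-ŝ v)) sv)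

    ℛ-elim : ∀ {k} → ℛ k X Y → k ≡ i × T (s v)
    ℛ-elim (_ , d , x) with B→ ρX d
    ... | refl , inj₁ ()
    ... | refl , inj₂ (inj₁ refl) = refl , subst T (val-ŝ v) (V→ ρY x)
    ... | refl , inj₂ (inj₂ ())

  ⊨₀-fresh : ∀ α → bound₀ α ≤ N → ∀ {u v X Y} → Realises u X → Realises v Y → X ⊨₀ α → Y ⊨₀ α
  ⊨₀-fresh (atom (good _)) _   ρX ρY _ = V← ρY tt
  ⊨₀-fresh (atom (bad _))  _   ρX ρY _ = V← ρY tt
  ⊨₀-fresh (atom (atm k))  k≤N {v = v} ρX ρY _ = V← ρY (subst T (sym (val-≤ v k≤N)) tt)
  ⊨₀-fresh (¬₀ α)          b   ρX ρY ¬x y = ¬x (⊨₀-fresh α b ρY ρX y)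
  ⊨₀-fresh (α ∧₀ β)        b   ρX ρY (x , y) =
    ⊨₀-fresh α (m⊔n≤o⇒m≤o _ _ b) ρX ρY x , ⊨₀-fresh β (m⊔n≤o⇒n≤o _ _ b) ρX ρY y
  ⊨₀-fresh (△ _ _)         _   ρX ρY x = B← ρY (B→ ρX x)

  app⇒holds : ∀ O {k φ u t X} → Realises u X → sat (U t) (st top) φ → sat (U t) (st t) φ →
    sat (U t) X (app O k φ) → k ≡ i × T (holds O t)
  app⇒holds opA ρ φtop φt h =
    proj₁ (𝒜-elim ρ (st-realises _) (h _ top∈U φtop)) , proj₂ (𝒜-elim ρ (st-realises _) (h _ t∈U φt))
  app⇒holds opR ρ φtop φt h =
    proj₁ (ℛ-elim ρ (st-realises _) (h _ top∈U φtop)) , proj₂ (ℛ-elim ρ (st-realises _) (h _ t∈U φt))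
  app⇒holds opAreal {k} {t = t} ρ φtop φt h =
    proj₁ (𝒜-elim ρ (st-realises _) (h _ top∈U φtop (ℰ-intro ρ (st-realises _) k tt))) ,
    ⇒ᵇ-intro (r t) (q t) λ rt →
      proj₂ (𝒜-elim ρ (st-realises _) (h _ t∈U φt (ℰ-intro ρ (st-realises _) k rt)))
  app⇒holds opRreal {k} {t = t} ρ φtop φt h =
    proj₁ (ℛ-elim ρ (st-realises _) (h _ top∈U φtop (ℰ-intro ρ (st-realises _) k tt))) ,
    ⇒ᵇ-intro (r t) (s t) λ rt →
      proj₂ (ℛ-elim ρ (st-realises _) (h _ t∈U φt (ℰ-intro ρ (st-realises _) k rt)))

  holds⇒app : ∀ O {φ u t X} → Realises u X → T (holds O t) → sat (U t) X (app O i φ)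
  holds⇒app opA     ρ h _ (_ , inj₁ refl , ρ') _   = 𝒜-intro ρ ρ' tt
  holds⇒app opA     ρ h _ (_ , inj₂ refl , ρ') _   = 𝒜-intro ρ ρ' h
  holds⇒app opR     ρ h _ (_ , inj₁ refl , ρ') _   = ℛ-intro ρ ρ' tt
  holds⇒app opR     ρ h _ (_ , inj₂ refl , ρ') _   = ℛ-intro ρ ρ' h
  holds⇒app opAreal ρ h _ (_ , inj₁ refl , ρ') _ _ = 𝒜-intro ρ ρ' tt
  holds⇒app opAreal {t = t} ρ h _ (_ , inj₂ refl , ρ') _ e =
    𝒜-intro ρ ρ' (⇒ᵇ-elim (r t) (q t) h (ℰ-elim ρ ρ' e))
  holds⇒app opRreal ρ h _ (_ , inj₁ refl , ρ') _ _ = ℛ-intro ρ ρ' tt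
  holds⇒app opRreal {t = t} ρ h _ (_ , inj₂ refl , ρ') _ e =
    ℛ-intro ρ ρ' (⇒ᵇ-elim (r t) (s t) h (ℰ-elim ρ ρ' e))

  Transfers : Triple → Triple → Form n → Set₁
  Transfers t t' φ = ∀ {u u' X X'} → Realises u X → Realises u' X' → sat (U t) X φ → sat (U t') X' φ

  transfer-app : ∀ {O t t'} O' {k φ} → Agree O t t' → ¬ (O ≡ O' × k ≡ i) →
    Transfers t' t φ → Transfers t t' (app O' k φ)
  -- If φ holds somewhere in U t', it holds everywhere in U t, so h forces k ≡ i and the
  -- bit of O' at t, which is also its bit at t' because O' ≢ O.
  transfer-app {t = t} {t'} O' {k} {φ} ag ne back {X' = X'} ρ ρ' h =
    app-fromSatisfiable O' k φ λ { _ (_ , _ , ρ'') φS' →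
      conclude (app⇒holds O' ρ (back ρ'' (st-realises top) φS') (back ρ'' (st-realises t) φS') h) }
    where
    conclude : k ≡ i × T (holds O' t) → sat (U t') X' (app O' k φ)
    conclude (refl , holds-t) =
      holds⇒app O' ρ' (subst T (ag O' (λ O≡O' → ne (O≡O' , refl))) holds-t)

  transfer : ∀ {O t t' ψ} → Agree O t t' → NoOcc O i ψ → bound ψ ≤ N → Transfers t t' ψ
  transfer ag (emb α)     b ρ ρ' (lift x) = lift (⊨₀-fresh α b ρ ρ' x)
  transfer ag (¬' no)     b ρ ρ' ¬x y     = ¬x (transfer (Agree-sym ag) no b ρ' ρ y)
  transfer ag (no ∧' no′) b ρ ρ' (x , y)  =
    transfer ag no (m⊔n≤o⇒m≤o _ _ b) ρ ρ' x , transfer ag no′ (m⊔n≤o⇒n≤o _ _ b) ρ ρ' y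
  transfer ag (□ k no)    b ρ ρ' h _ (_ , _ , ρ'') _ =
    transfer ag no b (st-realises top) ρ'' (h _ top∈U (ℰ-intro ρ (st-realises top) k tt))
  transfer ag (𝖠 k ne no)     b = transfer-app opA     ag ne (transfer (Agree-sym ag) no b)
  transfer ag (𝖱 k ne no)     b = transfer-app opR     ag ne (transfer (Agree-sym ag) no b)
  transfer ag (𝖠real k ne no) b = transfer-app opAreal ag ne (transfer (Agree-sym ag) no b)
  transfer ag (𝖱real k ne no) b = transfer-app opRreal ag ne (transfer (Agree-sym ag) no b)

record Separation (O : Op) : Set where
  field
    t⁺ t⁻  : Triple
    agree  : Agree O t⁺ t⁻
    holds⁺ : T (holds O t⁺)
    holds⁻ : ¬ T (holds O t⁻)

separation : ∀ O → Separation O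
separation opA = record
  { t⁺ = top ; t⁻ = ⟨ false , false , true ⟩ ; holds⁺ = tt ; holds⁻ = λ ()
  ; agree = λ { opA ne → ⊥-elim (ne refl) ; opR _ → refl ; opAreal _ → refl ; opRreal _ → refl } }
separation opR = record
  { t⁺ = top ; t⁻ = ⟨ true , false , false ⟩ ; holds⁺ = tt ; holds⁻ = λ ()
  ; agree = λ { opR ne → ⊥-elim (ne refl) ; opA _ → refl ; opAreal _ → refl ; opRreal _ → refl } }
separation opAreal = record
  { t⁺ = ⟨ false , false , true ⟩ ; t⁻ = ⟨ false , true , true ⟩ ; holds⁺ = tt ; holds⁻ = λ ()
  ; agree = λ { opAreal ne → ⊥-elim (ne refl) ; opA _ → refl ; opR _ → refl ; opRreal _ → refl } }
separation opRreal = record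
  { t⁺ = ⟨ true , false , false ⟩ ; t⁻ = ⟨ true , true , false ⟩ ; holds⁺ = tt ; holds⁻ = λ ()
  ; agree = λ { opRreal ne → ⊥-elim (ne refl) ; opA _ → refl ; opR _ → refl ; opAreal _ → refl } }

not-definable : ∀ {n} (i : Fin n) O {ψ : Form n} →
  NoOcc O i ψ → ¬ Valid (app O i (emb (atom (atm 0))) ⇔' ψ)
not-definable i O {ψ} noOcc valid = proj₁ (valid (U t⁺) (st top) top∈U) (O-at-t⁺ , ¬ψ-at-t⁺)
  where
  open Construction i (bound ψ)
  open Separation (separation O)

  p : Form _
  p = emb (atom (atm 0))

  p-everywhere : ∀ v → st v ⊨₀ atom (atm 0)
  p-everywhere v = subst T (sym (val-≤ v z≤n)) tt

  O-at-t⁺ : sat (U t⁺) (st top) (app O i p)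
  O-at-t⁺ = holds⇒app O (st-realises top) holds⁺

  ¬O-at-t⁻ : ¬ sat (U t⁻) (st top) (app O i p)
  ¬O-at-t⁻ h =
    holds⁻ (proj₂ (app⇒holds O (st-realises top) (lift (p-everywhere top)) (lift (p-everywhere t⁻)) h))

  ¬ψ-at-t⁺ : ¬ sat (U t⁺) (st top) ψ
  ¬ψ-at-t⁺ x = proj₂ (valid (U t⁻) (st top) top∈U) (ψ-at-t⁻ , ¬O-at-t⁻)
    where
    ψ-at-t⁻ : sat (U t⁻) (st top) ψ
    ψ-at-t⁻ = transfer agree noOcc ≤-refl (st-realises top) (st-realises top) x

theorem1 : (n : ℕ) (i : Fin n) (O : Op) →
    Σ (Atm n) λ p →
    ¬ (Σ (Form n) λ ψ → NoOcc O i ψ × Valid (app O i (emb (atom p)) ⇔' ψ))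
theorem1 n i O = atm 0 , λ (ψ , noOcc , valid) → not-definable i O noOcc valid
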